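{- For every connected graph $G$, there is a simple protocol for multiparty equality on $G$ in the local broadcast model with per-bit cost at most $2\cdot\frac{\gamma(G)}{\gamma^*(G)}\cdot \mathrm{opt}(G)$.
   Context: Multiparty equality in the local broadcast model: every vertex of a connected graph $G$ receives a $k$-bit input string. A message broadcast by a vertex is received by all its neighbors. Protocols are deterministic and static: which vertices send and the lengths of messages depend only on $G$ and $k$; message contents may depend on the sender's input and received messages. At the end each vertex accepts or rejects; correctness requires that if all inputs are equal all vertices accept, and if two inputs differ at least one vertex rejects. The total cost is the total number of bits broadcast (each broadcast counted once). $\mathrm{opt}(G,k)$ is the minimum total cost of a correct protocol for $k$-bit inputs and $\mathrm{opt}(G)=\lim_{k\to\infty}\mathrm{opt}(G,k)/k$. A simple protocol with broadcasting set $S$: each vertex of $S$ broadcasts its entire input, others are silent, and each vertex accepts iff all received inputs equal its own; its per-bit cost is $|S|$. $\gamma(G)$ (denoted $\tau_{\rm balls}(G)$ in the paper) is the domination number of $G$, and $\gamma^*(G)$ (denoted $\tau^*_{\rm balls}(G)$) is the fractional domination number: the minimum of $\sum_v x(v)$ over nonnegative real $x$ with $\sum_{v\in N[u]}x(v)\ge1$ for all $u$, where $N[u]$ is the closed neighborhood. -}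

module Defs where

open import Data.Bool using (Bool; true; false; _∧_; if_then_else_)
open import Data.Nat using (ℕ; zero; suc; _+_; _*_; _≤_; NonZero)
open import Data.Fin using (Fin)
open import Data.List using (List; []; _∷_; _++_; [_]; length; map; concat; filter; allFin; foldr; replicate)
open import Data.Nat.ListAction using (sum)
open import Data.List.Relation.Unary.Unique.Propositional using (Unique)
open import Data.List.Membership.Propositional using (_∈_)
import Data.List.Properties as LP
open import Data.Vec using (Vec; toList)
open import Data.Product using (Σ; _×_; _,_; proj₁; proj₂; ∃)
open import Data.Sum using (_⊎_)
open import Data.Integer using (+_)
open import Data.Rational using (ℚ; _/_; 0ℚ; 1ℚ) renaming (_+_ to _+ℚ_; _≤_ to _≤ℚ_)
open import Relation.Binary.PropositionalEquality using (_≡_; _≢_)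
open import Relation.Nullary using (¬_; does)
open import Relation.Nullary.Decidable using (⌊_⌋)
import Data.Bool.Properties as BP

record Graph (n : ℕ) : Set where
  field
    Adj     : Fin n → Fin n → Bool
    symm    : ∀ u v → Adj u v ≡ Adj v u
    irrefl  : ∀ v → Adj v v ≡ false
open Graph public

data Walk {n : ℕ} (G : Graph n) : Fin n → Fin n → Set where
  here : ∀ {u} → Walk G u u
  step : ∀ {u w v} → Adj G u w ≡ true → Walk G w v → Walk G u v

Connected : ∀ {n} → Graph n → Set
Connected {n} G = NonZero n × (∀ u v → Walk G u v)

InClosedNbhd : ∀ {n} → Graph n → Fin n → Fin n → Set
InClosedNbhd G u v = (v ≡ u) ⊎ (Adj G v u ≡ true)

Dominating : ∀ {n} → Graph n → List (Fin n) → Set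
Dominating {n} G D = Unique D × (∀ u → Σ (Fin n) λ v → v ∈ D × InClosedNbhd G u v)

IsDominationNumber : ∀ {n} → Graph n → ℕ → Set
IsDominationNumber G g =
  (Σ _ λ D → Dominating G D × length D ≡ g) ×
  (∀ D → Dominating G D → g ≤ length D)

closedNbhd? : ∀ {n} → Graph n → Fin n → Fin n → Bool
closedNbhd? G u v = ⌊ v Data.Fin.≟ u ⌋ Data.Bool.∨ Adj G v u

sumℚ : List ℚ → ℚ
sumℚ = foldr _+ℚ_ 0ℚ

ℕ→ℚ : ℕ → ℚ
ℕ→ℚ m = + m / 1

FracDominating : ∀ {n} → Graph n → (Fin n → ℚ) → Set
FracDominating {n} G x =
  (∀ v → 0ℚ ≤ℚ x v) ×
  (∀ u → 1ℚ ≤ℚ sumℚ (map (λ v → if closedNbhd? G u v then x v else 0ℚ) (allFin n)))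

-- t is the fractional domination number γ*(G) (minimum of the LP;
-- the LP has rational data, so its minimum is rational and attained)
IsFracDominationNumber : ∀ {n} → Graph n → ℚ → Set
IsFracDominationNumber {n} G t =
  (Σ (Fin n → ℚ) λ x → FracDominating G x × sumℚ (map x (allFin n)) ≡ t) ×
  (∀ x → FracDominating G x → t ≤ℚ sumℚ (map x (allFin n)))

Bits : ℕ → Set
Bits k = Vec Bool k

fit : ℕ → List Bool → List Bool
fit zero    _        = []
fit (suc ℓ) []       = false ∷ fit ℓ []
fit (suc ℓ) (b ∷ bs) = b ∷ fit ℓ bs

-- The schedule (who broadcasts, in which
-- order, and how many bits) is fixed in advance (static).  The message of
-- the i-th broadcast is computed from the sender's input and the
-- concatenation of all bits the sender has received so far (since the
-- schedule is static, this concatenation determines the individual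
-- messages).
record Protocol (n k : ℕ) : Set where
  field
    schedule : List (Fin n × ℕ)
    speak    : ℕ → Bits k → List Bool → List Bool
    decide   : Fin n → Bits k → List Bool → Bool
open Protocol public

cost : ∀ {n k} → Protocol n k → ℕ
cost P = sum (map proj₂ (schedule P))

module _ {n : ℕ} (G : Graph n) where

  heard : Fin n → List (Fin n × List Bool) → List Bool
  heard v tr = concat (map proj₂ (filter (λ m → Data.Bool.T? (Adj G (proj₁ m) v)) tr))

  run : ∀ {k} → Protocol n k → (Fin n → Bits k) →
        ℕ → List (Fin n × ℕ) → List (Fin n × List Bool) → List (Fin n × List Bool)
  run P x i []              acc = acc
  run P x i ((v , ℓ) ∷ sch) acc =
    run P x (suc i) sch (acc ++ [ (v , fit ℓ (speak P i (x v) (heard v acc))) ])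

  transcript : ∀ {k} → Protocol n k → (Fin n → Bits k) → List (Fin n × List Bool)
  transcript P x = run P x 0 (schedule P) []

  accepts : ∀ {k} → Protocol n k → (Fin n → Bits k) → Fin n → Bool
  accepts P x v = decide P v (x v) (heard v (transcript P x))

  Correct : ∀ {k} → Protocol n k → Set
  Correct {k} P =
    (∀ (x : Fin n → Bits k) → (∀ u v → x u ≡ x v) → ∀ v → accepts P x v ≡ true) ×
    (∀ (x : Fin n → Bits k) u w → x u ≢ x w → Σ (Fin n) λ v → accepts P x v ≡ false)

  simple : (S : List (Fin n)) (k : ℕ) → Protocol n k
  simple S k = record
    { schedule = map (λ v → (v , k)) S
    ; speak    = λ _ y _ → toList y
    ; decide   = λ v y r →
        ⌊ LP.≡-dec BP._≟_ r
            (concat (map (λ _ → toList y) (filter (λ u → Data.Bool.T? (Adj G u v)) S))) ⌋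
    }

module Submission where

-- Let P be correct and let u have some other vertex w.  If two constant inputs a ≠ b
-- produced the same messages inside the closed neighbourhood N[u], then the input that is a at u and
-- b elsewhere would produce the transcript of b with u hearing what it hears under a, so every vertex
-- would accept it.  Hence a ↦ (bits broadcast inside N[u]) is injective on k-bit strings, and at
-- least k bits are broadcast inside every N[u].  Dividing the number of bits sent by each vertex by k
-- therefore gives a fractional dominating function, so γ*·k ≤ cost(P).
--
-- Call S spanning if the edges incident to S connect all vertices.  Starting from one
-- vertex of a minimum dominating set D, repeatedly take an edge pq leaving the region linked so far
-- and add p together with a dominator of q; this attaches a new dominator with its whole closed
-- neighbourhood at the price of two vertices, giving a spanning S with |S| ≤ 2γ.  The simple protocol
-- on a spanning set is correct, and |S|·γ*·k ≤ 2γ·γ*·k ≤ 2γ·cost(P) for every k.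

open import Defs
open import Data.Bool using (Bool; true; false; T; if_then_else_)
open import Data.Bool.Properties using (T-≡; ¬-not)
import Data.Bool.Properties as Bool
open import Data.Empty using (⊥-elim)
open import Data.Fin as Fin using (Fin; _≟_; combine; funToFin; finToFun)
open import Data.Fin.Properties
  using (all?; ¬∀⟶∃¬; 2↔Bool; funToFin-finToFin; finToFun-funToFin; injective⇒≤; punchInᵢ≢i)
open import Data.Integer using (+_; +≤+)
import Data.Integer as ℤ
import Data.Integer.Properties as ℤ
open import Data.List using (List; []; _∷_; _++_; [_]; length; map; concat; filter; allFin; tabulate; deduplicate)
open import Data.List.Properties
  using (∷-injectiveˡ; ∷-injectiveʳ; ++-identityʳ; ++-assoc; filter-++; filter-notAll; filter-all;
         length-++; length-deduplicate; map-cong; map-tabulate)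
import Data.List.Properties as List
open import Data.List.Membership.Propositional using (_∈_; _∉_; find; lose)
open import Data.List.Membership.Propositional.Properties using (∈-filter⁺; ∈-filter⁻; ∈-deduplicate⁺)
open import Data.List.Relation.Binary.Subset.Propositional using (_⊆_)
import Data.List.Relation.Unary.All as All
open import Data.List.Relation.Unary.AllPairs using ([])
open import Data.List.Relation.Unary.Any using (here; there)
import Data.List.Relation.Unary.Any as Any
open import Data.List.Relation.Unary.Unique.Propositional using (Unique)
open import Data.List.Relation.Unary.Unique.DecPropositional.Properties using (deduplicate-!)
open import Data.Nat as ℕ using (ℕ; zero; suc; NonZero)
import Data.Nat.Properties as ℕ
open import Data.Nat.Coprimality using (1-coprimeTo)
import Data.Nat.Coprimality as Coprime
open import Data.Nat.ListAction using (sum)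
open import Algebra.Properties.CommutativeMonoid.Sum ℕ.+-0-commutativeMonoid
  using (∑-distrib-+; sum-remove; sum-cong-≗; sum-replicate-zero) renaming (sum to ∑)
open import Data.Product using (Σ; Σ-syntax; _×_; _,_; proj₁; proj₂; map₂)
open import Data.Rational as ℚ
  using (ℚ; mkℚ; 0ℚ; 1ℚ; _<_; _≤_; _+_; _*_; *≤*; 1/_; NonNegative; nonNegative)
import Data.Rational.Properties as ℚ
open import Data.Sum using (inj₁; inj₂)
open import Data.Unit using (tt)
open import Data.Vec using (lookup; fromList; toList; cast)
import Data.Vec.Properties as Vec
open import Data.Vec.Functional using (removeAt)
open import Function using (_∘_; id; case_of_; Equivalence; Inverse)
open import Relation.Nullary using (¬_; Dec; yes; no; ¬?; contradiction)
open import Relation.Nullary.Decidable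
  using (T?; ⌊_⌋; toWitness; fromWitness; decidable-stable; _×-dec_; _⊎-dec_)
open import Relation.Unary using (Decidable)
open import Relation.Binary.PropositionalEquality
  using (_≡_; _≢_; _≗_; refl; sym; trans; cong; cong₂; subst; subst₂; module ≡-Reasoning)

++-injective : ∀ {A : Set} (xs ys : List A) {zs ws} → length xs ≡ length ys →
               xs ++ zs ≡ ys ++ ws → xs ≡ ys × zs ≡ ws
++-injective []       []       _    eq = refl , eq
++-injective (x ∷ xs) (y ∷ ys) ∣eq∣ eq
  with xs≡ys , zs≡ws ← ++-injective xs ys (ℕ.suc-injective ∣eq∣) (∷-injectiveʳ eq) =
  cong₂ _∷_ (∷-injectiveˡ eq) xs≡ys , zs≡ws

concat-map-injective : ∀ {A B : Set} (f g : A → List B) → (∀ a → length (f a) ≡ length (g a)) →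
                       ∀ {as} → concat (map f as) ≡ concat (map g as) → ∀ {a} → a ∈ as → f a ≡ g a
concat-map-injective f g ∣eq∣ {b ∷ _} eq (here refl) = proj₁ (++-injective (f b) (g b) (∣eq∣ b) eq)
concat-map-injective f g ∣eq∣ {b ∷ _} eq (there a∈) =
  concat-map-injective f g ∣eq∣ (proj₂ (++-injective (f b) (g b) (∣eq∣ b) eq)) a∈

filter-absorb : ∀ {A : Set} {P Q : A → Set} (P? : Decidable P) (Q? : Decidable Q) →
                (∀ {x} → P x → Q x) → ∀ xs → filter P? (filter Q? xs) ≡ filter P? xs
filter-absorb P? Q? P⇒Q []       = refl
filter-absorb P? Q? P⇒Q (x ∷ xs) with Q? x
... | yes _ with P? x
...   | yes _ = cong (x ∷_) (filter-absorb P? Q? P⇒Q xs)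
...   | no _  = filter-absorb P? Q? P⇒Q xs
filter-absorb P? Q? P⇒Q (x ∷ xs) | no ¬Qx with P? x
...   | yes Px = contradiction (P⇒Q Px) ¬Qx
...   | no _   = filter-absorb P? Q? P⇒Q xs

fit-toList : ∀ {k} (y : Bits k) → fit k (toList y) ≡ toList y
fit-toList Data.Vec.[]      = refl
fit-toList (b Data.Vec.∷ y) = cong (b ∷_) (fit-toList y)

length-fit : ∀ ℓ bs → length (fit ℓ bs) ≡ ℓ
length-fit zero    bs       = refl
length-fit (suc ℓ) []       = cong suc (length-fit ℓ [])
length-fit (suc ℓ) (b ∷ bs) = cong suc (length-fit ℓ bs)

module _ where
  open Inverse 2↔Bool using (to; from; strictlyInverseˡ; strictlyInverseʳ)

  funToFin-cong : ∀ {m n} {f g : Fin m → Fin n} → f ≗ g → funToFin f ≡ funToFin g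
  funToFin-cong {zero}  f≗g = refl
  funToFin-cong {suc m} f≗g = cong₂ combine (f≗g Fin.zero) (funToFin-cong (f≗g ∘ Fin.suc))

  bitsToFin : ∀ {k} → Bits k → Fin (2 ℕ.^ k)
  bitsToFin v = funToFin (from ∘ lookup v)

  finToBits : ∀ {k} → Fin (2 ℕ.^ k) → Bits k
  finToBits i = Data.Vec.tabulate (to ∘ finToFun i)

  finToBits-bitsToFin : ∀ {k} (v : Bits k) → finToBits (bitsToFin v) ≡ v
  finToBits-bitsToFin v = trans
    (Vec.tabulate-cong λ i → trans (cong to (finToFun-funToFin (from ∘ lookup v) i)) (strictlyInverseˡ (lookup v i)))
    (Vec.tabulate∘lookup v)

  bitsToFin-finToBits : ∀ {k} (i : Fin (2 ℕ.^ k)) → bitsToFin {k} (finToBits i) ≡ i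
  bitsToFin-finToBits {k} i = trans
    (funToFin-cong {k} λ j → trans (cong from (Vec.lookup∘tabulate (to ∘ finToFun i) j)) (strictlyInverseʳ (finToFun i j)))
    (funToFin-finToFin {k} {2} i)

  bits-injection⇒≤ : ∀ {k ℓ} (f : Bits k → Bits ℓ) → (∀ {a b} → f a ≡ f b → a ≡ b) → k ℕ.≤ ℓ
  bits-injection⇒≤ {k} {ℓ} f f-injective =
    ℕ.≮⇒≥ λ ℓ<k → ℕ.<⇒≱ (ℕ.^-monoʳ-< 2 (ℕ.s≤s (ℕ.s≤s ℕ.z≤n)) ℓ<k) (injective⇒≤ {f = bitsToFin ∘ f ∘ finToBits} injective)
    where
    injective : ∀ {i j} → bitsToFin (f (finToBits i)) ≡ bitsToFin (f (finToBits j)) → i ≡ j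
    injective {i} {j} eq = trans (sym (bitsToFin-finToBits {k} i)) (trans
      (cong (bitsToFin {k}) (f-injective (trans (sym (finToBits-bitsToFin _)) (trans (cong finToBits eq) (finToBits-bitsToFin _)))))
      (bitsToFin-finToBits {k} j))

fixedLength-injection⇒≤ : ∀ {k ℓ} (f : Bits k → List Bool) → (∀ a → length (f a) ≡ ℓ) →
                          (∀ {a b} → f a ≡ f b → a ≡ b) → k ℕ.≤ ℓ
fixedLength-injection⇒≤ {ℓ = ℓ} f ∣f∣≡ℓ f-injective =
  bits-injection⇒≤ asBits λ {a} {b} eq → f-injective (trans (sym (toList-asBits a)) (trans (cong toList eq) (toList-asBits b)))
  where
  asBits : Bits _ → Bits ℓ
  asBits a = cast (∣f∣≡ℓ a) (fromList (f a))
  toList-asBits : ∀ a → toList (asBits a) ≡ f a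
  toList-asBits a = trans (Vec.toList-cast (∣f∣≡ℓ a) (fromList (f a))) (Vec.toList∘fromList (f a))

sum-tabulate : ∀ {n} (f : Fin n → ℕ) → sum (tabulate f) ≡ ∑ f
sum-tabulate {zero}  f = refl
sum-tabulate {suc n} f = cong (f Fin.zero ℕ.+_) (sum-tabulate (f ∘ Fin.suc))

sum-map-allFin : ∀ {n} (f : Fin n → ℕ) → sum (map f (allFin n)) ≡ ∑ f
sum-map-allFin f = trans (cong sum (map-tabulate id f)) (sum-tabulate f)

∑-single : ∀ {n} (f : Fin n → ℕ) s → (∀ v → v ≢ s → f v ≡ 0) → ∑ f ≡ f s
∑-single {suc n} f s vanishes = begin
  ∑ f                       ≡⟨ sum-remove {i = s} f ⟩
  f s ℕ.+ ∑ (removeAt f s)  ≡⟨ cong (f s ℕ.+_) (trans (sum-cong-≗ (λ j → vanishes _ (punchInᵢ≢i s j))) (sum-replicate-zero n)) ⟩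
  f s ℕ.+ 0                 ≡⟨ ℕ.+-identityʳ (f s) ⟩
  f s                       ∎
  where open ≡-Reasoning

fromℕ : ℕ → ℚ
fromℕ m = mkℚ (+ m) 0 (Coprime.sym (1-coprimeTo m))

ℕ→ℚ≡fromℕ : ∀ m → ℕ→ℚ m ≡ fromℕ m
ℕ→ℚ≡fromℕ m = ℚ.normalize-coprime (Coprime.sym (1-coprimeTo m))

ℕ→ℚ-+ : ∀ a b → ℕ→ℚ (a ℕ.+ b) ≡ ℕ→ℚ a + ℕ→ℚ b
ℕ→ℚ-+ a b rewrite ℕ→ℚ≡fromℕ a | ℕ→ℚ≡fromℕ b | ℤ.*-identityʳ (+ a) | ℤ.*-identityʳ (+ b) = refl

ℕ→ℚ-* : ∀ a b → ℕ→ℚ (a ℕ.* b) ≡ ℕ→ℚ a * ℕ→ℚ b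
ℕ→ℚ-* a b rewrite ℕ→ℚ≡fromℕ a | ℕ→ℚ≡fromℕ b | sym (ℤ.pos-* a b) = refl

ℕ→ℚ-mono-≤ : ∀ {a b} → a ℕ.≤ b → ℕ→ℚ a ≤ ℕ→ℚ b
ℕ→ℚ-mono-≤ {a} {b} a≤b rewrite ℕ→ℚ≡fromℕ a | ℕ→ℚ≡fromℕ b =
  *≤* (subst₂ ℤ._≤_ (sym (ℤ.*-identityʳ (+ a))) (sym (ℤ.*-identityʳ (+ b))) (+≤+ a≤b))

ℕ→ℚ-nonNeg : ∀ m → NonNegative (ℕ→ℚ m)
ℕ→ℚ-nonNeg m = subst NonNegative (sym (ℕ→ℚ≡fromℕ m)) _

sumℚ-scaled : ∀ {A : Set} (h : A → ℕ) q xs → sumℚ (map (λ a → ℕ→ℚ (h a) * q) xs) ≡ ℕ→ℚ (sum (map h xs)) * q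
sumℚ-scaled h q []       = sym (ℚ.*-zeroˡ q)
sumℚ-scaled h q (a ∷ xs) = trans (cong (_+_ (ℕ→ℚ (h a) * q)) (sumℚ-scaled h q xs))
  (trans (sym (ℚ.*-distribʳ-+ q (ℕ→ℚ (h a)) _)) (cong (_* q) (sym (ℕ→ℚ-+ (h a) _))))

-- Spanning sets

module _ {n : ℕ} (G : Graph n) where

  EdgeConstant : {A : Set} → List (Fin n) → (Fin n → A) → Set
  EdgeConstant S x = ∀ {a b} → a ∈ S → Adj G a b ≡ true → x a ≡ x b

  Linked : List (Fin n) → Fin n → Fin n → Set₁
  Linked S v w = ∀ {A : Set} (x : Fin n → A) → EdgeConstant S x → x v ≡ x w

  Spanning : List (Fin n) → Set₁
  Spanning S = ∀ v w → Linked S v w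

  Linked-sym : ∀ {S v w} → Linked S v w → Linked S w v
  Linked-sym v~w x ec = sym (v~w x ec)

  Linked-trans : ∀ {S u v w} → Linked S u v → Linked S v w → Linked S u w
  Linked-trans u~v v~w x ec = trans (u~v x ec) (v~w x ec)

  Linked-mono : ∀ {S S′ v w} → S ⊆ S′ → Linked S v w → Linked S′ v w
  Linked-mono S⊆S′ v~w x ec = v~w x (λ a∈S → ec (S⊆S′ a∈S))

  Linked-edge : ∀ {S a b} → a ∈ S → Adj G a b ≡ true → Linked S a b
  Linked-edge a∈S ab x ec = ec a∈S ab

  Linked-closedNbhd : ∀ {S d v} → d ∈ S → InClosedNbhd G v d → Linked S d v
  Linked-closedNbhd d∈S (inj₁ refl) x ec = refl
  Linked-closedNbhd d∈S (inj₂ dv)   = Linked-edge d∈S dv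

  inClosedNbhd? : ∀ v d → Dec (InClosedNbhd G v d)
  inClosedNbhd? v d = (d ≟ v) ⊎-dec (Adj G d v Bool.≟ true)

  walk-crossing : ∀ {p} {C : Fin n → Set p} → Decidable C → ∀ {a b} → Walk G a b → C a → ¬ C b →
                  Σ[ u ∈ Fin n ] Σ[ w ∈ Fin n ] C u × ¬ C w × Adj G u w ≡ true
  walk-crossing C? here                   Ca ¬Cb = contradiction Ca ¬Cb
  walk-crossing C? (step {w = w} aw walk) Ca ¬Cb with C? w
  ... | yes Cw = walk-crossing C? walk Cw ¬Cb
  ... | no ¬Cw = _ , w , Ca , ¬Cw , aw

  module Growth (connected : ∀ u v → Walk G u v) (D : List (Fin n))
                (dominated : ∀ u → Σ[ d ∈ Fin n ] d ∈ D × InClosedNbhd G u d)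
                (d₀ : Fin n) (d₀∈D : d₀ ∈ D) where
    open import Data.List.Membership.DecPropositional (_≟_ {n}) using (_∈?_)

    Covered : List (Fin n) → Fin n → Set
    Covered R v = Σ[ d ∈ Fin n ] d ∈ D × d ∉ R × InClosedNbhd G v d

    covered? : ∀ R → Decidable (Covered R)
    covered? R v with Any.any? (λ d → ¬? (d ∈? R) ×-dec inClosedNbhd? v d) D
    ... | yes found = let (d , d∈D , d∉R , vd) = find found in yes (d , d∈D , d∉R , vd)
    ... | no none   = no λ (d , d∈D , d∉R , vd) → none (lose d∈D (d∉R , vd))

    -- R holds the dominators whose closed neighbourhoods are not yet known to be linked to d₀.
    record Stage : Set₁ where
      field
        S      : List (Fin n)
        R      : List (Fin n)
        d₀∉R   : d₀ ∉ R
        linked : ∀ {v} → Covered R v → Linked S d₀ v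
        size   : length S ℕ.+ 2 ℕ.* length R ℕ.≤ 2 ℕ.* length D

    without : Fin n → List (Fin n) → List (Fin n)
    without d = filter (λ e → ¬? (e ≟ d))

    without-shrinks : ∀ {d R} → d ∈ R → length (without d R) ℕ.< length R
    without-shrinks d∈R = filter-notAll (λ e → ¬? (e ≟ _)) _ (Any.map (λ d≡e e≢d → e≢d (sym d≡e)) d∈R)

    ∈-without⁺ : ∀ {d e R} → e ∈ R → e ≢ d → e ∈ without d R
    ∈-without⁺ = ∈-filter⁺ (λ e → ¬? (e ≟ _))

    ∈-without⁻ : ∀ {d e} R → e ∈ without d R → e ∈ R
    ∈-without⁻ {d} R e∈ = proj₁ (∈-filter⁻ (λ e → ¬? (e ≟ d)) {xs = R} e∈)

    ∉-without : ∀ d R → d ∉ without d R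
    ∉-without d R d∈ = proj₂ (∈-filter⁻ (λ e → ¬? (e ≟ d)) {xs = R} d∈) refl

    start : Stage
    start = record
      { S      = [ d₀ ]
      ; R      = without d₀ D
      ; d₀∉R   = ∉-without d₀ D
      ; linked = linked₀
      ; size   = ℕ.≤-trans (ℕ.n≤1+n _) (ℕ.≤-trans (ℕ.≤-reflexive (sym (ℕ.*-suc 2 _))) (ℕ.*-monoʳ-≤ 2 (without-shrinks d₀∈D)))
      }
      where
      linked₀ : ∀ {v} → Covered (without d₀ D) v → Linked [ d₀ ] d₀ v
      linked₀ (d , d∈D , d∉R , vd) with d ≟ d₀
      ... | yes refl = Linked-closedNbhd (here refl) vd
      ... | no d≢d₀  = contradiction (∈-without⁺ d∈D d≢d₀) d∉R

    module _ (st : Stage) where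
      open Stage st

      attach : ∀ {p q d} → Covered R p → Adj G p q ≡ true → d ∈ R → InClosedNbhd G q d → Stage
      attach {p} {q} {d} p-covered pq d∈R qd = record
        { S      = p ∷ d ∷ S
        ; R      = without d R
        ; d₀∉R   = d₀∉R ∘ ∈-without⁻ R
        ; linked = linked′
        ; size   = ℕ.≤-trans two-more-fit size
        }
        where
        S⊆S′ : S ⊆ p ∷ d ∷ S
        S⊆S′ e∈S = there (there e∈S)
        linked′ : ∀ {v} → Covered (without d R) v → Linked (p ∷ d ∷ S) d₀ v
        linked′ (e , e∈D , e∉R′ , ve) with e ≟ d
        ... | yes refl = Linked-trans (Linked-mono S⊆S′ (linked p-covered))
                           (Linked-trans (Linked-edge (here refl) pq)
                           (Linked-trans (Linked-sym (Linked-closedNbhd (there (here refl)) qd))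
                                         (Linked-closedNbhd (there (here refl)) ve)))
        ... | no e≢d   = Linked-mono S⊆S′ (linked (e , e∈D , (λ e∈R → e∉R′ (∈-without⁺ e∈R e≢d)) , ve))
        two-more-fit : 2 ℕ.+ (length S ℕ.+ 2 ℕ.* length (without d R)) ℕ.≤ length S ℕ.+ 2 ℕ.* length R
        two-more-fit = ℕ.≤-trans (ℕ.≤-reflexive eq) (ℕ.+-monoʳ-≤ s (ℕ.*-monoʳ-≤ 2 (without-shrinks d∈R)))
          where
          s = length S
          r′ = length (without d R)
          eq : 2 ℕ.+ (s ℕ.+ 2 ℕ.* r′) ≡ s ℕ.+ 2 ℕ.* suc r′
          eq = sym (trans (cong (s ℕ.+_) (ℕ.*-suc 2 r′)) (trans (ℕ.+-suc s _) (cong suc (ℕ.+-suc s _))))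

      extend : ¬ (∀ v → Covered R v) → Σ[ st′ ∈ Stage ] length (Stage.R st′) ℕ.< length R
      extend notAll with ¬∀⟶∃¬ n _ (covered? R) notAll
      ... | q₀ , q₀-uncovered
          with walk-crossing (covered? R) (connected d₀ q₀) (d₀ , d₀∈D , d₀∉R , inj₁ refl) q₀-uncovered
      ... | p , q , p-covered , q-uncovered , pq with dominated q
      ... | d , d∈D , qd with d ∈? R
      ... | no d∉R  = contradiction (d , d∈D , d∉R , qd) q-uncovered
      ... | yes d∈R = attach p-covered pq d∈R qd , without-shrinks d∈R

    grow : ∀ m (st : Stage) → length (Stage.R st) ℕ.≤ m →
           Σ[ S ∈ List (Fin n) ] (∀ v → Linked S d₀ v) × length S ℕ.≤ 2 ℕ.* length D
    grow m st R≤m with all? (covered? (Stage.R st))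
    grow m       st R≤m | yes allCovered =
      Stage.S st , (λ v → Stage.linked st (allCovered v)) , ℕ.m+n≤o⇒m≤o _ (Stage.size st)
    grow zero    st R≤m | no notAll = contradiction (ℕ.≤-trans (proj₂ (extend st notAll)) R≤m) λ ()
    grow (suc m) st R≤m | no notAll =
      grow m (proj₁ (extend st notAll)) (ℕ.≤-pred (ℕ.≤-trans (proj₂ (extend st notAll)) R≤m))

  dominating⇒spanning : (∀ u v → Walk G u v) → ∀ D → (∀ u → Σ[ d ∈ Fin n ] d ∈ D × InClosedNbhd G u d) →
                        ∀ {d₀} → d₀ ∈ D → Σ[ S ∈ List (Fin n) ] Unique S × Spanning S × length S ℕ.≤ 2 ℕ.* length D
  dominating⇒spanning connected D dominated {d₀} d₀∈D =
    deduplicate _≟_ S , deduplicate-! _≟_ S ,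
    (λ v w → Linked-mono (∈-deduplicate⁺ _≟_) (Linked-trans (Linked-sym (d₀~ v)) (d₀~ w))) ,
    ℕ.≤-trans (length-deduplicate _≟_ S) |S|≤
    where
    open Growth connected D dominated d₀ d₀∈D
    grown = grow _ start ℕ.≤-refl
    S = proj₁ grown
    d₀~ = proj₁ (proj₂ grown)
    |S|≤ = proj₂ (proj₂ grown)

-- The simple protocol

module _ {n : ℕ} (G : Graph n) where

  inNbrs : List (Fin n) → Fin n → List (Fin n)
  inNbrs S v = filter (λ u → T? (Adj G u v)) S

  broadcast : ∀ {k} → (Fin n → Bits k) → List (Fin n) → List (Fin n × List Bool)
  broadcast x = map (λ v → v , toList (x v))

  run-simple : ∀ S {k} (x : Fin n → Bits k) i T acc →
               run G (simple G S k) x i (map (λ v → v , k) T) acc ≡ acc ++ broadcast x T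
  run-simple S x i []      acc = sym (++-identityʳ acc)
  run-simple S x i (v ∷ T) acc rewrite fit-toList (x v)
    | run-simple S x (suc i) T (acc ++ [ v , toList (x v) ]) = ++-assoc acc _ _

  heard-broadcast : ∀ {k} (x : Fin n → Bits k) v T →
                    heard G v (broadcast x T) ≡ concat (map (toList ∘ x) (inNbrs T v))
  heard-broadcast x v []      = refl
  heard-broadcast x v (u ∷ T) with Adj G u v
  ... | true  = cong (toList (x u) ++_) (heard-broadcast x v T)
  ... | false = heard-broadcast x v T

  accepts-simple : ∀ S {k} (x : Fin n → Bits k) v →
                   accepts G (simple G S k) x v ≡
                   ⌊ List.≡-dec Bool._≟_ (concat (map (toList ∘ x) (inNbrs S v)))
                                         (concat (map (λ _ → toList (x v)) (inNbrs S v))) ⌋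
  accepts-simple S x v rewrite run-simple S x 0 S [] | heard-broadcast x v S = refl

  accepting⇒edgeConstant : ∀ S {k} (x : Fin n → Bits k) → (∀ v → accepts G (simple G S k) x v ≡ true) →
                           EdgeConstant G S x
  accepting⇒edgeConstant S x accepting {a} {b} a∈S ab =
    trans (sym (Vec.cast-is-id refl (x a))) (Vec.toList-injective refl (x a) (x b)
      (concat-map-injective (toList ∘ x) (λ _ → toList (x b))
        (λ c → trans (Vec.length-toList (x c)) (sym (Vec.length-toList (x b))))
        received≡own (∈-filter⁺ (λ u → T? (Adj G u b)) a∈S (Equivalence.from T-≡ ab))))
    where
    received≡own = toWitness (Equivalence.from T-≡ (trans (sym (accepts-simple S x b)) (accepting b)))

  simple-correct : ∀ {S} → Spanning G S → ∀ k → Correct G (simple G S k)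
  simple-correct {S} spanning k = complete , sound
    where
    complete : ∀ (x : Fin n → Bits k) → (∀ u v → x u ≡ x v) → ∀ v → accepts G (simple G S k) x v ≡ true
    complete x constant v rewrite accepts-simple S x v =
      Equivalence.to T-≡ (fromWitness (cong concat (map-cong (λ u → cong toList (constant u v)) (inNbrs S v))))
    sound : ∀ (x : Fin n → Bits k) u w → x u ≢ x w → Σ[ v ∈ Fin n ] accepts G (simple G S k) x v ≡ false
    sound x u w xu≢xw with ¬∀⟶∃¬ n _ (λ v → accepts G (simple G S k) x v Bool.≟ true) notAllAccept
      where
      notAllAccept : ¬ (∀ v → accepts G (simple G S k) x v ≡ true)
      notAllAccept accepting = xu≢xw (spanning u w x (accepting⇒edgeConstant S x accepting))
    ... | v , rejects = v , ¬-not rejects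

module _ {n : ℕ} where

  sent : Fin n × ℕ → Fin n → ℕ
  sent (s , ℓ) v = if ⌊ s ≟ v ⌋ then ℓ else 0

  load : List (Fin n × ℕ) → Fin n → ℕ
  load []        v = 0
  load (e ∷ sch) v = sent e v ℕ.+ load sch v

  restrictedCost : (Fin n → Bool) → List (Fin n × ℕ) → ℕ
  restrictedCost p sch = sum (map proj₂ (filter (λ e → T? (p (proj₁ e))) sch))

  restrictedCost-all : ∀ sch → restrictedCost (λ _ → true) sch ≡ sum (map proj₂ sch)
  restrictedCost-all sch = cong (sum ∘ map proj₂) (filter-all (λ e → T? true) (All.universal _ sch))

  restrictedCost≡∑load : ∀ p sch → restrictedCost p sch ≡ ∑ (λ v → if p v then load sch v else 0)
  restrictedCost≡∑load p []              = sym (trans (sum-cong-≗ (λ v → if-0 (p v))) (sum-replicate-zero n))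
    where
    if-0 : ∀ b → (if b then 0 else 0) ≡ 0
    if-0 true  = refl
    if-0 false = refl
  restrictedCost≡∑load p ((s , ℓ) ∷ sch) = begin
    restrictedCost p ((s , ℓ) ∷ sch)
      ≡⟨ restrictedCost-∷ ⟩
    (if p s then ℓ else 0) ℕ.+ restrictedCost p sch
      ≡⟨ cong₂ ℕ._+_ (sym (trans (∑-single masked-sent s masked-sent-vanishes) (masked-sent-self (p s))))
                     (restrictedCost≡∑load p sch) ⟩
    ∑ masked-sent ℕ.+ ∑ masked-load
      ≡⟨ sym (∑-distrib-+ masked-sent masked-load) ⟩
    ∑ (λ v → masked-sent v ℕ.+ masked-load v)
      ≡⟨ sum-cong-≗ (λ v → sym (if-+ (p v))) ⟩
    ∑ (λ v → if p v then load ((s , ℓ) ∷ sch) v else 0) ∎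
    where
    open ≡-Reasoning
    masked-sent masked-load : Fin n → ℕ
    masked-sent v = if p v then sent (s , ℓ) v else 0
    masked-load v = if p v then load sch v else 0
    restrictedCost-∷ : restrictedCost p ((s , ℓ) ∷ sch) ≡ (if p s then ℓ else 0) ℕ.+ restrictedCost p sch
    restrictedCost-∷ with p s
    ... | true  = refl
    ... | false = refl
    masked-sent-vanishes : ∀ v → v ≢ s → masked-sent v ≡ 0
    masked-sent-vanishes v v≢s with s ≟ v | p v
    ... | yes s≡v | _     = contradiction (sym s≡v) v≢s
    ... | no _    | true  = refl
    ... | no _    | false = refl
    masked-sent-self : ∀ b → (if b then sent (s , ℓ) s else 0) ≡ (if b then ℓ else 0)
    masked-sent-self false = refl
    masked-sent-self true with s ≟ s
    ... | yes _  = refl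
    ... | no s≢s = contradiction refl s≢s
    if-+ : ∀ b {x y} → (if b then x ℕ.+ y else 0) ≡ (if b then x else 0) ℕ.+ (if b then y else 0)
    if-+ true  = refl
    if-+ false = refl

sumℚ-masked-load : ∀ {n} (sch : List (Fin n × ℕ)) q (p : Fin n → Bool) →
  sumℚ (map (λ v → if p v then ℕ→ℚ (load sch v) * q else 0ℚ) (allFin n)) ≡ ℕ→ℚ (restrictedCost p sch) * q
sumℚ-masked-load {n} sch q p = begin
  sumℚ (map (λ v → if p v then ℕ→ℚ (load sch v) * q else 0ℚ) (allFin n))
    ≡⟨ cong sumℚ (map-cong (λ v → masked-scaled (p v)) (allFin n)) ⟩
  sumℚ (map (λ v → ℕ→ℚ (masked-load v) * q) (allFin n))
    ≡⟨ sumℚ-scaled masked-load q (allFin n) ⟩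
  ℕ→ℚ (sum (map masked-load (allFin n))) * q
    ≡⟨ cong (λ c → ℕ→ℚ c * q) (trans (sum-map-allFin masked-load) (sym (restrictedCost≡∑load p sch))) ⟩
  ℕ→ℚ (restrictedCost p sch) * q ∎
  where
  open ≡-Reasoning
  masked-load : Fin n → ℕ
  masked-load v = if p v then load sch v else 0
  masked-scaled : ∀ {l} b → (if b then ℕ→ℚ l * q else 0ℚ) ≡ ℕ→ℚ (if b then l else 0) * q
  masked-scaled true  = refl
  masked-scaled false = sym (ℚ.*-zeroˡ q)

-- Fooling-set lower bound

module _ {n : ℕ} where

  payload : List (Fin n × List Bool) → List Bool
  payload tr = concat (map proj₂ tr)

  sizes : List (Fin n × List Bool) → List (Fin n × ℕ)
  sizes = map (map₂ length)

  length-payload : ∀ tr → length (payload tr) ≡ sum (map proj₂ (sizes tr))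
  length-payload []             = refl
  length-payload ((v , m) ∷ tr) = trans (length-++ m) (cong (length m ℕ.+_) (length-payload tr))

  payload-injective : ∀ tr tr′ → sizes tr ≡ sizes tr′ → payload tr ≡ payload tr′ → tr ≡ tr′
  payload-injective []             []               _  _  = refl
  payload-injective ((v , m) ∷ tr) ((v′ , m′) ∷ tr′) sz eq
    with m≡m′ , rest ← ++-injective m m′ (cong proj₂ (∷-injectiveˡ sz)) eq =
    cong₂ _∷_ (cong₂ _,_ (cong proj₁ (∷-injectiveˡ sz)) m≡m′) (payload-injective tr tr′ (∷-injectiveʳ sz) rest)

module _ {n : ℕ} (G : Graph n) where

  nearby : ∀ {A : Set} → Fin n → List (Fin n × A) → List (Fin n × A)
  nearby u = filter (λ m → T? (closedNbhd? G u (proj₁ m)))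

  nearby-map₂ : ∀ {A B : Set} (f : A → B) u xs → nearby u (map (map₂ f) xs) ≡ map (map₂ f) (nearby u xs)
  nearby-map₂ f u []             = refl
  nearby-map₂ f u ((v , a) ∷ xs) with closedNbhd? G u v
  ... | true  = cong (_ ∷_) (nearby-map₂ f u xs)
  ... | false = nearby-map₂ f u xs

  nearby-∷-injective : ∀ {A : Set} {u v} {a b : A} {xs ys} →
                       nearby u ((v , a) ∷ xs) ≡ nearby u ((v , b) ∷ ys) →
                       (T (closedNbhd? G u v) → a ≡ b) × nearby u [ v , a ] ≡ nearby u [ v , b ] × nearby u xs ≡ nearby u ys
  nearby-∷-injective {u = u} {v} eq with closedNbhd? G u v
  ... | true  = (λ _ → cong proj₂ (∷-injectiveˡ eq)) , cong [_] (∷-injectiveˡ eq) , ∷-injectiveʳ eq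
  ... | false = (λ ()) , refl , eq

  adj⇒closedNbhd : ∀ {u s} → T (Adj G s u) → T (closedNbhd? G u s)
  adj⇒closedNbhd {u} {s} s→u with s ≟ u
  ... | yes _ = tt
  ... | no _  = s→u

  heard-nearby : ∀ u tr → heard G u (nearby u tr) ≡ heard G u tr
  heard-nearby u tr = cong payload (filter-absorb _ _ adj⇒closedNbhd tr)

  module _ {k : ℕ} (P : Protocol n k) where

    nearbyCost : Fin n → ℕ
    nearbyCost u = restrictedCost (closedNbhd? G u) (schedule P)

    message : (Fin n → Bits k) → ℕ → Fin n × ℕ → List (Fin n × List Bool) → List Bool
    message x i (v , ℓ) acc = fit ℓ (speak P i (x v) (heard G v acc))

    continuation : (Fin n → Bits k) → ℕ → List (Fin n × ℕ) → List (Fin n × List Bool) → List (Fin n × List Bool)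
    continuation x i []              acc = []
    continuation x i ((v , ℓ) ∷ sch) acc = (v , m) ∷ continuation x (suc i) sch (acc ++ [ v , m ])
      where m = message x i (v , ℓ) acc

    run≡++continuation : ∀ x i sch acc → run G P x i sch acc ≡ acc ++ continuation x i sch acc
    run≡++continuation x i []              acc = sym (++-identityʳ acc)
    run≡++continuation x i ((v , ℓ) ∷ sch) acc =
      trans (run≡++continuation x (suc i) sch (acc ++ [ v , m ])) (++-assoc acc [ v , m ] _)
      where m = message x i (v , ℓ) acc

    transcript≡continuation : ∀ x → transcript G P x ≡ continuation x 0 (schedule P) []
    transcript≡continuation x = run≡++continuation x 0 (schedule P) []

    sizes-continuation : ∀ x i sch acc → sizes (continuation x i sch acc) ≡ sch
    sizes-continuation x i []              acc = refl
    sizes-continuation x i ((v , ℓ) ∷ sch) acc =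
      cong₂ _∷_ (cong (v ,_) (length-fit ℓ _)) (sizes-continuation x (suc i) sch _)

    module Hybrid (u : Fin n) (x x′ z : Fin n → Bits k)
                  (z-at-u : z u ≡ x u) (z-elsewhere : ∀ v → v ≢ u → z v ≡ x′ v) where

      message-hybrid : ∀ i v ℓ accA accB → nearby u accA ≡ nearby u accB →
                       (T (closedNbhd? G u v) → message x i (v , ℓ) accA ≡ message x′ i (v , ℓ) accB) →
                       message z i (v , ℓ) accB ≡ message x′ i (v , ℓ) accB
      message-hybrid i v ℓ accA accB accs≈ mA≡mB with v ≟ u
      ... | no v≢u   = cong (λ y → fit ℓ (speak P i y (heard G v accB))) (z-elsewhere v v≢u)
      ... | yes refl = trans (cong₂ (λ y h → fit ℓ (speak P i y h)) z-at-u heardB≡heardA) (mA≡mB tt)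
        where
        heardB≡heardA : heard G u accB ≡ heard G u accA
        heardB≡heardA = trans (sym (heard-nearby u accB)) (trans (cong (heard G u) (sym accs≈)) (heard-nearby u accA))

      continuation-hybrid : ∀ i sch accA accB → nearby u accA ≡ nearby u accB →
        nearby u (continuation x i sch accA) ≡ nearby u (continuation x′ i sch accB) →
        continuation z i sch accB ≡ continuation x′ i sch accB
      continuation-hybrid i []              accA accB _     _     = refl
      continuation-hybrid i ((v , ℓ) ∷ sch) accA accB accs≈ rest≈
        with mA≡mB , headsA≈B , tails≈ ← nearby-∷-injective rest≈ =
        trans (cong (λ m → (v , m) ∷ continuation z (suc i) sch (accB ++ [ v , m ]))
                    (message-hybrid i v ℓ accA accB accs≈ mA≡mB))
              (cong ((v , mB) ∷_) (continuation-hybrid (suc i) sch _ _ accs≈′ tails≈))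
        where
        mA = message x i (v , ℓ) accA
        mB = message x′ i (v , ℓ) accB
        accs≈′ : nearby u (accA ++ [ v , mA ]) ≡ nearby u (accB ++ [ v , mB ])
        accs≈′ = trans (filter-++ _ accA _) (trans (cong₂ _++_ accs≈ headsA≈B) (sym (filter-++ _ accB _)))

      transcript-hybrid : nearby u (transcript G P x) ≡ nearby u (transcript G P x′) →
                          transcript G P z ≡ transcript G P x′
      transcript-hybrid near≈ =
        trans (transcript≡continuation z) (trans (continuation-hybrid 0 (schedule P) [] [] refl
          (subst₂ (λ tr tr′ → nearby u tr ≡ nearby u tr′) (transcript≡continuation x) (transcript≡continuation x′) near≈))
          (sym (transcript≡continuation x′)))

      accepts-hybrid-at : nearby u (transcript G P x) ≡ nearby u (transcript G P x′) →
                          accepts G P z u ≡ accepts G P x u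
      accepts-hybrid-at near≈ = cong₂ (decide P u) z-at-u (begin
        heard G u (transcript G P z)             ≡⟨ cong (heard G u) (transcript-hybrid near≈) ⟩
        heard G u (transcript G P x′)            ≡⟨ sym (heard-nearby u (transcript G P x′)) ⟩
        heard G u (nearby u (transcript G P x′)) ≡⟨ cong (heard G u) (sym near≈) ⟩
        heard G u (nearby u (transcript G P x))  ≡⟨ heard-nearby u (transcript G P x) ⟩
        heard G u (transcript G P x)             ∎)
        where open ≡-Reasoning

      accepts-hybrid-elsewhere : nearby u (transcript G P x) ≡ nearby u (transcript G P x′) →
                                 ∀ v → v ≢ u → accepts G P z v ≡ accepts G P x′ v
      accepts-hybrid-elsewhere near≈ v v≢u =
        cong₂ (decide P v) (z-elsewhere v v≢u) (cong (heard G v) (transcript-hybrid near≈))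

    nearby-transcript-injective : Correct G P → ∀ {u w} → w ≢ u → ∀ a b →
      nearby u (transcript G P (λ _ → a)) ≡ nearby u (transcript G P (λ _ → b)) → a ≡ b
    nearby-transcript-injective (complete , sound) {u} {w} w≢u a b near≈ =
      decidable-stable (Vec.≡-dec Bool._≟_ a b) λ a≢b →
        let (v , rejects) = sound glued u w (λ eq → a≢b (trans (sym glued-at-u) (trans eq (glued-elsewhere w w≢u))))
        in contradiction (trans (sym (glued-accepts v)) rejects) λ ()
      where
      glued : Fin n → Bits k
      glued v with v ≟ u
      ... | yes _ = a
      ... | no _  = b
      glued-at-u : glued u ≡ a
      glued-at-u with u ≟ u
      ... | yes _  = refl
      ... | no u≢u = contradiction refl u≢u
      glued-elsewhere : ∀ v → v ≢ u → glued v ≡ b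
      glued-elsewhere v v≢u with v ≟ u
      ... | yes v≡u = contradiction v≡u v≢u
      ... | no _    = refl
      open Hybrid u (λ _ → a) (λ _ → b) glued glued-at-u glued-elsewhere
      glued-accepts : ∀ v → accepts G P glued v ≡ true
      glued-accepts v = case v ≟ u of λ where
        (yes refl) → trans (accepts-hybrid-at near≈) (complete _ (λ _ _ → refl) u)
        (no v≢u)   → trans (accepts-hybrid-elsewhere near≈ v v≢u) (complete _ (λ _ _ → refl) v)

    correct⇒k≤nearbyCost : Correct G P → ∀ {u w} → w ≢ u → k ℕ.≤ nearbyCost u
    correct⇒k≤nearbyCost correct {u} w≢u = fixedLength-injection⇒≤ heardNearby length-heardNearby
      λ {a} {b} eq → nearby-transcript-injective correct w≢u a b
        (payload-injective _ _ (trans (sizes-nearby a) (sym (sizes-nearby b))) eq)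
      where
      heardNearby : Bits k → List Bool
      heardNearby a = payload (nearby u (transcript G P (λ _ → a)))
      sizes-nearby : ∀ a → sizes (nearby u (transcript G P (λ _ → a))) ≡ nearby u (schedule P)
      sizes-nearby a = trans (sym (nearby-map₂ length u (transcript G P (λ _ → a)))) (cong (nearby u)
        (trans (cong sizes (transcript≡continuation (λ _ → a))) (sizes-continuation (λ _ → a) 0 (schedule P) [])))
      length-heardNearby : ∀ a → length (heardNearby a) ≡ nearbyCost u
      length-heardNearby a = trans (length-payload (nearby u (transcript G P (λ _ → a))))
        (cong (λ sz → sum (map proj₂ sz)) (sizes-nearby a))

-- Fractional domination

module _ {n : ℕ} (G : Graph n) where

  -- The loads of P divided by k form a fractional dominating function.
  fracDominationNumber*k≤cost : ∀ {t} → IsFracDominationNumber G t → ∀ {k} (P : Protocol n k) →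
                                (∀ u → k ℕ.≤ nearbyCost G P u) → t * ℕ→ℚ k ≤ ℕ→ℚ (cost P)
  fracDominationNumber*k≤cost {t} _ {zero} P _ =
    subst (_≤ ℕ→ℚ (cost P)) (sym (ℚ.*-zeroʳ t)) (ℕ→ℚ-mono-≤ {b = cost P} ℕ.z≤n)
  fracDominationNumber*k≤cost {t} (_ , optimal) {suc k} P k≤nearby = begin
    t * K                                         ≤⟨ ℚ.*-monoʳ-≤-nonNeg K {{ℕ→ℚ-nonNeg (suc k)}} (optimal x x-dominating) ⟩
    sumℚ (map x (allFin n)) * K                   ≡⟨ cong (_* K) (sumℚ-masked-load sch q (λ _ → true)) ⟩
    ℕ→ℚ (restrictedCost (λ _ → true) sch) * q * K ≡⟨ cong (λ c → ℕ→ℚ c * q * K) (restrictedCost-all sch) ⟩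
    ℕ→ℚ (cost P) * q * K                          ≡⟨ ℚ.*-assoc (ℕ→ℚ (cost P)) q K ⟩
    ℕ→ℚ (cost P) * (q * K)                        ≡⟨ cong (ℕ→ℚ (cost P) *_) q*K≡1 ⟩
    ℕ→ℚ (cost P) * 1ℚ                             ≡⟨ ℚ.*-identityʳ (ℕ→ℚ (cost P)) ⟩
    ℕ→ℚ (cost P)                                  ∎
    where
    open ℚ.≤-Reasoning
    sch = schedule P
    K = ℕ→ℚ (suc k)
    q = 1/ fromℕ (suc k)
    q*K≡1 : q * K ≡ 1ℚ
    q*K≡1 = trans (cong (q *_) (ℕ→ℚ≡fromℕ (suc k))) (ℚ.*-inverseˡ (fromℕ (suc k)))
    instance
      q-nonNeg : NonNegative q
      q-nonNeg = ℚ.pos⇒nonNeg q {{ℚ.1/pos⇒pos (fromℕ (suc k))}}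
    x : Fin n → ℚ
    x v = ℕ→ℚ (load sch v) * q
    x-dominating : FracDominating G x
    x-dominating = (λ v → ℚ.nonNegative⁻¹ (x v) {{ℚ.nonNeg*nonNeg⇒nonNeg (ℕ→ℚ (load sch v)) {{ℕ→ℚ-nonNeg (load sch v)}} q}}) ,
      λ u → begin
        1ℚ                          ≡⟨ sym (trans (ℚ.*-comm K q) q*K≡1) ⟩
        K * q                       ≤⟨ ℚ.*-monoʳ-≤-nonNeg q (ℕ→ℚ-mono-≤ (k≤nearby u)) ⟩
        ℕ→ℚ (nearbyCost G P u) * q  ≡⟨ sym (sumℚ-masked-load sch q (closedNbhd? G u)) ⟩
        sumℚ (map (λ v → if closedNbhd? G u v then x v else 0ℚ) (allFin n)) ∎

x≤x+ε*k : ∀ x ε k → 0ℚ < ε → x ≤ x + ε * ℕ→ℚ k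
x≤x+ε*k x ε k ε>0 = begin
  x              ≡⟨ sym (ℚ.+-identityʳ x) ⟩
  x + 0ℚ         ≤⟨ ℚ.+-monoʳ-≤ x (ℚ.nonNegative⁻¹ (ε * ℕ→ℚ k) {{εk-nonNeg}}) ⟩
  x + ε * ℕ→ℚ k  ∎
  where
  open ℚ.≤-Reasoning
  εk-nonNeg : NonNegative (ε * ℕ→ℚ k)
  εk-nonNeg = ℚ.nonNeg*nonNeg⇒nonNeg ε {{nonNegative (ℚ.<⇒≤ ε>0)}} (ℕ→ℚ k) {{ℕ→ℚ-nonNeg k}}

s*t*k≤2g*c : ∀ {s} g c k {t} → s ℕ.≤ 2 ℕ.* g → t * ℕ→ℚ k ≤ ℕ→ℚ c → ℕ→ℚ s * t * ℕ→ℚ k ≤ ℕ→ℚ 2 * ℕ→ℚ g * ℕ→ℚ c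
s*t*k≤2g*c {s} g c k {t} s≤2g tk≤c = begin
  ℕ→ℚ s * t * ℕ→ℚ k      ≡⟨ ℚ.*-assoc (ℕ→ℚ s) t (ℕ→ℚ k) ⟩
  ℕ→ℚ s * (t * ℕ→ℚ k)    ≤⟨ ℚ.*-monoˡ-≤-nonNeg (ℕ→ℚ s) {{ℕ→ℚ-nonNeg s}} tk≤c ⟩
  ℕ→ℚ s * ℕ→ℚ c          ≤⟨ ℚ.*-monoʳ-≤-nonNeg (ℕ→ℚ c) {{ℕ→ℚ-nonNeg c}} (subst (ℕ→ℚ s ≤_) (ℕ→ℚ-* 2 g) (ℕ→ℚ-mono-≤ s≤2g)) ⟩
  ℕ→ℚ 2 * ℕ→ℚ g * ℕ→ℚ c  ∎
  where open ℚ.≤-Reasoning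

0*t*k≤2g*c : ∀ g c k t → ℕ→ℚ 0 * t * ℕ→ℚ k ≤ ℕ→ℚ 2 * ℕ→ℚ g * ℕ→ℚ c
0*t*k≤2g*c g c k t = begin
  ℕ→ℚ 0 * t * ℕ→ℚ k      ≡⟨ trans (cong (_* ℕ→ℚ k) (ℚ.*-zeroˡ t)) (ℚ.*-zeroˡ (ℕ→ℚ k)) ⟩
  0ℚ                     ≤⟨ ℚ.nonNegative⁻¹ _ {{2gc-nonNeg}} ⟩
  ℕ→ℚ 2 * ℕ→ℚ g * ℕ→ℚ c  ∎
  where
  open ℚ.≤-Reasoning
  2gc-nonNeg : NonNegative (ℕ→ℚ 2 * ℕ→ℚ g * ℕ→ℚ c)
  2gc-nonNeg = subst NonNegative (trans (ℕ→ℚ-* (2 ℕ.* g) c) (cong (_* ℕ→ℚ c) (ℕ→ℚ-* 2 g))) (ℕ→ℚ-nonNeg (2 ℕ.* g ℕ.* c))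

another : ∀ {m} (u : Fin (suc (suc m))) → Σ (Fin (suc (suc m))) λ w → w ≢ u
another Fin.zero    = Fin.suc Fin.zero , λ ()
another (Fin.suc _) = Fin.zero , λ ()

corollary3p3 : ∀ {n} (G : Graph n) → Connected G →
    ∀ (g : ℕ) (t : ℚ) → IsDominationNumber G g → IsFracDominationNumber G t →
    Σ (List (Fin n)) λ S → Unique S × (∀ k → Correct G (simple G S k)) ×
      (∀ (ε : ℚ) → 0ℚ < ε → Σ ℕ λ N → ∀ k → N ℕ.≤ k →
        ∀ (P : Protocol n k) → Correct G P →
          ℕ→ℚ (length S) * t * ℕ→ℚ k ≤
            ℕ→ℚ 2 * ℕ→ℚ g * ℕ→ℚ (cost P) + ε * ℕ→ℚ k)
corollary3p3 {zero} G (nonZero , _) = ⊥-elim (NonZero.nonZero nonZero)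
corollary3p3 {suc zero} G _ g t _ _ =
  [] , [] , simple-correct G single-vertex-spanning ,
  λ ε ε>0 → 0 , λ k _ P _ → ℚ.≤-trans (0*t*k≤2g*c g (cost P) k t) (x≤x+ε*k _ ε k ε>0)
  where
  single-vertex-spanning : Spanning G []
  single-vertex-spanning Fin.zero Fin.zero x _ = refl
corollary3p3 {suc (suc m)} G (_ , connected) g t ((D , (_ , dominated) , |D|≡g) , _) isFrac
  with S , unique , spanning , |S|≤2|D| ← dominating⇒spanning G connected D dominated (proj₁ (proj₂ (dominated Fin.zero))) =
  S , unique , simple-correct G spanning ,
  λ ε ε>0 → 0 , λ k _ P correct → ℚ.≤-trans
    (s*t*k≤2g*c g (cost P) k (subst (λ d → length S ℕ.≤ 2 ℕ.* d) |D|≡g |S|≤2|D|)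
      (fracDominationNumber*k≤cost G isFrac P λ u → correct⇒k≤nearbyCost G P correct (proj₂ (another u))))
    (x≤x+ε*k _ ε k ε>0)
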